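{- Let $D_1,D_2$ be delta-matroids on $[n_1,\overline{n_1}]$ and $[n_2,\overline{n_2}]$. Then $U_{D_1\times D_2}(u,v)=U_{D_1}(u,v)\,U_{D_2}(u,v)$.
   Context: Let $[n,\overline{n}]=\{1,\dots,n,\overline{1},\dots,\overline{n}\}$ with involution $a\mapsto\overline a$; $\overline S=\{\overline a:a\in S\}$. Admissible sets contain at most one of $i,\overline i$ for each $i$; $\operatorname{AdS}_n$ is their set. A delta-matroid on $[n,\overline n]$ is a non-empty collection $\mathcal F$ of admissible sets of size $n$ (feasible sets) such that $\operatorname{Conv}\{e_B:B\in\mathcal F\}$ has all edges parallel to some $e_i$ or $e_i\pm e_j$ ($e_{\overline i}=-e_i$, $e_S=\sum_{a\in S}e_a$); rank function $g_D(S)=\max_{B\in\mathcal F}(|S\cap B|-|\overline S\cap B|)$; $U_D(u,v)=\sum_{S\in\operatorname{AdS}_n}u^{n-|S|}v^{(|S|-g_D(S))/2}$. Identifying the disjoint union of $[n_1]$ and $[n_2]$ with $[n_1+n_2]$, $D_1\times D_2$ is the delta-matroid on $[n_1+n_2,\overline{n_1+n_2}]$ with feasible sets $B_1\cup B_2$, $B_j$ feasible in $D_j$. -}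

module Defs where

open import Data.Nat as ℕ using (ℕ; zero; suc; _∸_)
open import Data.Integer as ℤ using (ℤ; +_; -[1+_]; _⊔_; _≤_)
open import Data.Bool using (Bool; true; false; if_then_else_; not)
open import Data.Maybe using (Maybe; just; nothing)
open import Data.Fin using (Fin)
open import Data.Fin.Properties using () renaming (_≟_ to _≟ᶠ_)
open import Data.Vec as Vec using (Vec; []; _∷_; _++_)
open import Data.List as List using (List; [])
open import Data.List.NonEmpty as List⁺ using (List⁺; _∷_)
open import Data.List.Membership.Propositional using (_∈_)
open import Data.Product using (Σ; ∃; ∃-syntax; _×_; _,_)
open import Data.Sum using (_⊎_)
open import Relation.Nullary using (¬_; does)
open import Relation.Binary.PropositionalEquality using (_≡_; _≢_)

-- Ground set [n, n̄]: the element i is (i , true), the element ī is (i , false).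
-- An admissible set S ⊆ [n, n̄] is a vector  Vec (Maybe Bool) n :
--   S[i] = just true  ⇔ i ∈ S,  S[i] = just false ⇔ ī ∈ S,  S[i] = nothing ⇔ neither.
-- Admissible sets of size n are exactly those with no 'nothing', so they are
-- represented as  Vec Bool n  (B[i] = true ⇔ i ∈ B, B[i] = false ⇔ ī ∈ B).

Adm : ℕ → Set
Adm n = Vec (Maybe Bool) n

Full : ℕ → Set
Full n = Vec Bool n

AdS : (n : ℕ) → List (Adm n)
AdS zero = Vec.[] List.∷ List.[]
AdS (suc n) = List.concatMap
  (λ S → (nothing ∷ S) List.∷ (just true ∷ S) List.∷ (just false ∷ S) List.∷ List.[])
  (AdS n)

size : ∀ {n} → Adm n → ℕ
size [] = 0
size (nothing ∷ S) = size S
size (just _ ∷ S) = suc (size S)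

capSize : ∀ {n} → Adm n → Full n → ℕ
capSize [] [] = 0
capSize (nothing ∷ S) (_ ∷ B) = capSize S B
capSize (just s ∷ S) (b ∷ B) = (if does (Data.Bool._≟_ s b) then 1 else 0) ℕ.+ capSize S B
  where import Data.Bool

bar : ∀ {n} → Adm n → Adm n
bar = Vec.map (λ { nothing → nothing ; (just s) → just (not s) })

record SetSystem (n : ℕ) : Set where
  constructor setSystem
  field
    feasible : List⁺ (Full n)
open SetSystem public

_∈F_ : ∀ {n} → Full n → SetSystem n → Set
B ∈F D = B ∈ List⁺.toList (feasible D)

-- e_B ∈ ℤ^n  (e_i ↦ +1, e_ī = -e_i ↦ -1)
eVec : ∀ {n} → Full n → Vec ℤ n
eVec = Vec.map (λ b → if b then + 1 else -[1+ 0 ])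

dot : ∀ {n} → Vec ℤ n → Vec ℤ n → ℤ
dot v w = Vec.foldr _ ℤ._+_ (+ 0) (Vec.zipWith ℤ._*_ v w)

unit : ∀ {n} → Fin n → Vec ℤ n
unit i = Vec.tabulate (λ k → if does (k ≟ᶠ i) then + 1 else + 0)

IsDirection : ∀ {n} → Vec ℤ n → Set
IsDirection {n} v =
  (∃[ i ] v ≡ unit i)
  ⊎ (∃[ i ] ∃[ j ] (i ≢ j × v ≡ Vec.zipWith ℤ._+_ (unit i) (unit j)))
  ⊎ (∃[ i ] ∃[ j ] (i ≢ j × v ≡ Vec.zipWith ℤ._-_ (unit i) (unit j)))

-- d is parallel to v : d = c v for some non-zero scalar c
-- (integer scalars suffice: v has an entry equal to 1)
Parallel : ∀ {n} → Vec ℤ n → Vec ℤ n → Set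
Parallel d v = ∃[ c ] (c ≢ + 0 × d ≡ Vec.map (c ℤ.*_) v)

-- [e_B, e_B'] is an edge of Conv{e_C : C ∈ F}: B ≠ B' and some linear
-- functional w attains its maximum over the points exactly at e_B and e_B'.
-- (All e_C are vertices of the cube, hence of the polytope; rational, hence
-- after scaling integral, functionals suffice to expose faces of a rational polytope.)
IsEdge : ∀ {n} → SetSystem n → Full n → Full n → Set
IsEdge {n} D B B' =
  B ≢ B' × Σ (Vec ℤ n) λ w →
     (∀ C → C ∈F D → dot w (eVec C) ≤ dot w (eVec B))
   × dot w (eVec B') ≡ dot w (eVec B)
   × (∀ C → C ∈F D → dot w (eVec C) ≡ dot w (eVec B) → C ≡ B ⊎ C ≡ B')

IsDeltaMatroid : ∀ {n} → SetSystem n → Set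
IsDeltaMatroid {n} D =
  ∀ B B' → B ∈F D → B' ∈F D → IsEdge D B B' →
    Σ (Vec ℤ n) λ v → IsDirection v × Parallel (Vec.zipWith ℤ._-_ (eVec B) (eVec B')) v

rankTerm : ∀ {n} → Adm n → Full n → ℤ
rankTerm S B = + capSize S B ℤ.- + capSize (bar S) B

maxList⁺ : List⁺ ℤ → ℤ
maxList⁺ (x ∷ xs) = List.foldr _⊔_ x xs

g : ∀ {n} → SetSystem n → Adm n → ℤ
g D S = maxList⁺ (List⁺.map (rankTerm S) (feasible D))

-- Formal polynomials in ℤ[u,v] with non-negative coefficients, represented
-- by their coefficient function: P a b = coefficient of u^a v^b.

Poly : Set
Poly = ℕ → ℕ → ℕ

sumUpTo : ℕ → (ℕ → ℕ) → ℕ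
sumUpTo zero f = f 0
sumUpTo (suc m) f = sumUpTo m f ℕ.+ f (suc m)

_*ᴾ_ : Poly → Poly → Poly
(P *ᴾ Q) a b = sumUpTo a λ a₁ → sumUpTo b λ b₁ → P a₁ b₁ ℕ.* Q (a ∸ a₁) (b ∸ b₁)

count : {A : Set} → (A → Bool) → List A → ℕ
count p xs = List.length (List.filter (λ x → Data.Bool._≟_ (p x) true) xs)
  where import Data.Bool

-- exponent of v for S:  (|S| − g_D(S)) / 2  (a non-negative integer)
vExp : ∀ {n} → SetSystem n → Adm n → ℕ
vExp D S = ℤ.∣ + size S ℤ.- g D S ∣ ℕ./ 2
  where import Data.Nat.DivMod

-- U_D(u,v) = Σ_{S ∈ AdS_n} u^{n−|S|} v^{(|S|−g_D(S))/2}
U : ∀ {n} → SetSystem n → Poly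
U {n} D a b = count (λ S → does ((n ∸ size S) ℕ.≟ a) Data.Bool.∧ does (vExp D S ℕ.≟ b)) (AdS n)
  where import Data.Bool

-- Product D₁ × D₂ on [n₁+n₂, \overline{n₁+n₂}]: feasible sets B₁ ∪ B₂
-- (the copy of [n₂] is identified with {n₁+1, …, n₁+n₂}).

_×D_ : ∀ {n₁ n₂} → SetSystem n₁ → SetSystem n₂ → SetSystem (n₁ ℕ.+ n₂)
D₁ ×D D₂ = setSystem
  (List⁺.concatMap (λ B₁ → List⁺.map (λ B₂ → B₁ ++ B₂) (feasible D₂)) (feasible D₁))

-- Every admissible set of the product splits as S₁ ∪ S₂, the feasible sets of
-- D₁ × D₂ are the unions B₁ ∪ B₂, and |S ∩ B| − |S̄ ∩ B| is additive, so the rank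
-- is additive: g(S₁ ∪ S₂) = g₁(S₁) + g₂(S₂). Both exponents n − |S| and
-- (|S| − g(S))/2 are therefore additive (the halving is exact, since
-- |S| − g(S) = 2|S̄ ∩ B| for a maximising B), so the monomial contributed by S is the
-- product of those contributed by S₁ and S₂, and summing over all pairs (S₁, S₂)
-- gives U_{D₁×D₂} = U_{D₁} U_{D₂}.
module Submission where

open import Defs
open import Data.Nat as ℕ using (ℕ; zero; suc; _+_; _*_; _∸_; _≤_; _<_; z≤n; s≤s)
open import Data.Nat.Properties
open import Data.Nat.DivMod using (m*n/n≡m)
open import Data.Nat.Tactic.RingSolver as ℕ-Solver using ()
open import Data.Integer as ℤ using (ℤ; +_)
import Data.Integer.Properties as ℤ
open import Data.Integer.Tactic.RingSolver as ℤ-Solver using ()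
open import Data.Bool as Bool using (Bool; true; false; _∧_; if_then_else_)
open import Data.Maybe using (just; nothing)
open import Data.Vec using ([]; _∷_; _++_)
open import Data.List as List using (List; cartesianProductWith)
open import Data.List.NonEmpty as List⁺ using (List⁺; _∷_; toList)
open import Data.List.Properties using (foldr-preservesʳ; foldr-preservesᵒ; map-++)
open import Data.Nat.ListAction using (sum)
open import Data.Nat.ListAction.Properties using (sum-++)
open import Data.List.Membership.Propositional using (_∈_)
open import Data.List.Membership.Propositional.Properties
  using (foldr-selective; ∈-map⁺; ∈-map⁻; ∈-cartesianProductWith⁺; ∈-cartesianProductWith⁻)
open import Data.List.Relation.Unary.Any as Any using (here; there)
open import Data.Product using (∃-syntax; _×_; _,_)
open import Data.Sum using (inj₁; inj₂; [_,_]′)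
open import Relation.Nullary using (does; yes; no; ¬_)
open import Relation.Nullary.Decidable using (dec-true; dec-false)
open import Relation.Binary.PropositionalEquality hiding ([_])

open ≡-Reasoning

size-++ : ∀ {m n} (S₁ : Adm m) (S₂ : Adm n) → size (S₁ ++ S₂) ≡ size S₁ + size S₂
size-++ []             S₂ = refl
size-++ (nothing ∷ S₁) S₂ = size-++ S₁ S₂
size-++ (just _ ∷ S₁)  S₂ = cong suc (size-++ S₁ S₂)

size≤n : ∀ {n} (S : Adm n) → size S ≤ n
size≤n []            = z≤n
size≤n (nothing ∷ S) = m≤n⇒m≤1+n (size≤n S)
size≤n (just _ ∷ S)  = s≤s (size≤n S)

bar-++ : ∀ {m n} (S₁ : Adm m) (S₂ : Adm n) → bar (S₁ ++ S₂) ≡ bar S₁ ++ bar S₂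
bar-++ []             S₂ = refl
bar-++ (nothing ∷ S₁) S₂ = cong (nothing ∷_) (bar-++ S₁ S₂)
bar-++ (just _ ∷ S₁)  S₂ = cong (just _ ∷_) (bar-++ S₁ S₂)

capSize-++ : ∀ {m n} (S₁ : Adm m) (S₂ : Adm n) (B₁ : Full m) (B₂ : Full n) →
  capSize (S₁ ++ S₂) (B₁ ++ B₂) ≡ capSize S₁ B₁ + capSize S₂ B₂
capSize-++ []             S₂ []       B₂ = refl
capSize-++ (nothing ∷ S₁) S₂ (_ ∷ B₁) B₂ = capSize-++ S₁ S₂ B₁ B₂
capSize-++ (just s ∷ S₁)  S₂ (b ∷ B₁) B₂ =
  trans (cong (λ z → agree + z) (capSize-++ S₁ S₂ B₁ B₂)) (sym (+-assoc agree (capSize S₁ B₁) _))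
  where agree = if does (s Bool.≟ b) then 1 else 0

capSize+capSize-bar≡size : ∀ {n} (S : Adm n) (B : Full n) →
  capSize S B + capSize (bar S) B ≡ size S
capSize+capSize-bar≡size []               []          = refl
capSize+capSize-bar≡size (nothing ∷ S)    (_ ∷ B)     = capSize+capSize-bar≡size S B
capSize+capSize-bar≡size (just true ∷ S)  (true ∷ B)  = cong suc (capSize+capSize-bar≡size S B)
capSize+capSize-bar≡size (just false ∷ S) (false ∷ B) = cong suc (capSize+capSize-bar≡size S B)
capSize+capSize-bar≡size (just true ∷ S)  (false ∷ B) =
  trans (+-suc _ _) (cong suc (capSize+capSize-bar≡size S B))
capSize+capSize-bar≡size (just false ∷ S) (true ∷ B)  =
  trans (+-suc _ _) (cong suc (capSize+capSize-bar≡size S B))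

[a+b]-[c+d]≡[a-c]+[b-d] : ∀ (a b c d : ℤ) → (a ℤ.+ b) ℤ.- (c ℤ.+ d) ≡ (a ℤ.- c) ℤ.+ (b ℤ.- d)
[a+b]-[c+d]≡[a-c]+[b-d] = ℤ-Solver.solve-∀

rankTerm-++ : ∀ {m n} (S₁ : Adm m) (S₂ : Adm n) (B₁ : Full m) (B₂ : Full n) →
  rankTerm (S₁ ++ S₂) (B₁ ++ B₂) ≡ rankTerm S₁ B₁ ℤ.+ rankTerm S₂ B₂
rankTerm-++ S₁ S₂ B₁ B₂ = begin
  + capSize (S₁ ++ S₂) (B₁ ++ B₂) ℤ.- + capSize (bar (S₁ ++ S₂)) (B₁ ++ B₂)
    ≡⟨ cong₂ (λ x y → + x ℤ.- + y) (capSize-++ S₁ S₂ B₁ B₂)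
         (trans (cong (λ T → capSize T (B₁ ++ B₂)) (bar-++ S₁ S₂)) (capSize-++ (bar S₁) (bar S₂) B₁ B₂)) ⟩
  + (a₁ + a₂) ℤ.- + (c₁ + c₂)
    ≡⟨ cong₂ ℤ._-_ (ℤ.pos-+ a₁ a₂) (ℤ.pos-+ c₁ c₂) ⟩
  (+ a₁ ℤ.+ + a₂) ℤ.- (+ c₁ ℤ.+ + c₂)
    ≡⟨ [a+b]-[c+d]≡[a-c]+[b-d] (+ a₁) (+ a₂) (+ c₁) (+ c₂) ⟩
  rankTerm S₁ B₁ ℤ.+ rankTerm S₂ B₂ ∎
  where
  a₁ = capSize S₁ B₁
  a₂ = capSize S₂ B₂
  c₁ = capSize (bar S₁) B₁
  c₂ = capSize (bar S₂) B₂

maxList⁺-∈ : (xs : List⁺ ℤ) → maxList⁺ xs ∈ toList xs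
maxList⁺-∈ (x ∷ xs) = [ here , there ]′ (foldr-selective {_•_ = ℤ._⊔_} ℤ.⊔-sel x xs)

∈⇒≤-maxList⁺ : ∀ {y} (xs : List⁺ ℤ) → y ∈ toList xs → y ℤ.≤ maxList⁺ xs
∈⇒≤-maxList⁺ (x ∷ xs) (here refl) =
  foldr-preservesʳ {P = x ℤ.≤_} {f = ℤ._⊔_} (λ z → ℤ.i≤j⇒i≤k⊔j z) ℤ.≤-refl xs
∈⇒≤-maxList⁺ {y} (x ∷ xs) (there y∈xs) =
  foldr-preservesᵒ {P = y ℤ.≤_} {f = ℤ._⊔_} (λ u v → [ ℤ.i≤j⇒i≤j⊔k v , ℤ.i≤j⇒i≤k⊔j u ]′) x xs
    (inj₂ (Any.map (λ { refl → ℤ.≤-refl }) y∈xs))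

g-attained : ∀ {n} (D : SetSystem n) (S : Adm n) → ∃[ B ] B ∈F D × g D S ≡ rankTerm S B
g-attained (setSystem Bs@(_ ∷ _)) S =
  ∈-map⁻ (rankTerm S) {xs = toList Bs} (maxList⁺-∈ (List⁺.map (rankTerm S) Bs))

rankTerm≤g : ∀ {n} (D : SetSystem n) (S : Adm n) {B : Full n} → B ∈F D → rankTerm S B ℤ.≤ g D S
rankTerm≤g (setSystem Bs@(_ ∷ _)) S B∈ =
  ∈⇒≤-maxList⁺ (List⁺.map (rankTerm S) Bs) (∈-map⁺ (rankTerm S) B∈)

toList-feasible-×D : ∀ {n₁ n₂} (D₁ : SetSystem n₁) (D₂ : SetSystem n₂) →
  toList (feasible (D₁ ×D D₂)) ≡ cartesianProductWith _++_ (toList (feasible D₁)) (toList (feasible D₂))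
toList-feasible-×D (setSystem (B₁ ∷ Bs₁)) (setSystem Bs₂@(_ ∷ _)) =
  cong (List.map (B₁ ++_) (toList Bs₂) List.++_) (concat-map-product Bs₁)
  where
  concat-map-product : ∀ Cs →
    List.concat (List.map toList (List.map (λ C → List⁺.map (C ++_) Bs₂) Cs)) ≡
    cartesianProductWith _++_ Cs (toList Bs₂)
  concat-map-product List.[]       = refl
  concat-map-product (C List.∷ Cs) = cong (List.map (C ++_) (toList Bs₂) List.++_) (concat-map-product Cs)

module _ {n₁ n₂} (D₁ : SetSystem n₁) (D₂ : SetSystem n₂) where

  ∈F-×D⁺ : ∀ {B₁ B₂} → B₁ ∈F D₁ → B₂ ∈F D₂ → (B₁ ++ B₂) ∈F (D₁ ×D D₂)
  ∈F-×D⁺ {B₁} {B₂} B₁∈ B₂∈ =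
    subst ((B₁ ++ B₂) ∈_) (sym (toList-feasible-×D D₁ D₂)) (∈-cartesianProductWith⁺ _++_ B₁∈ B₂∈)

  ∈F-×D⁻ : ∀ {C} → C ∈F (D₁ ×D D₂) → ∃[ B₁ ] ∃[ B₂ ] B₁ ∈F D₁ × B₂ ∈F D₂ × C ≡ B₁ ++ B₂
  ∈F-×D⁻ {C} C∈ = ∈-cartesianProductWith⁻ _++_ _ _ (subst (C ∈_) (toList-feasible-×D D₁ D₂) C∈)

  g-×D : ∀ (S₁ : Adm n₁) (S₂ : Adm n₂) → g (D₁ ×D D₂) (S₁ ++ S₂) ≡ g D₁ S₁ ℤ.+ g D₂ S₂
  g-×D S₁ S₂ = ℤ.≤-antisym g-×D≤ g-×D≥
    where
    g-×D≤ : g (D₁ ×D D₂) (S₁ ++ S₂) ℤ.≤ g D₁ S₁ ℤ.+ g D₂ S₂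
    g-×D≤ with g-attained (D₁ ×D D₂) (S₁ ++ S₂)
    ... | C , C∈ , gC with ∈F-×D⁻ C∈
    ... | B₁ , B₂ , B₁∈ , B₂∈ , refl =
      subst (ℤ._≤ g D₁ S₁ ℤ.+ g D₂ S₂) (sym (trans gC (rankTerm-++ S₁ S₂ B₁ B₂)))
        (ℤ.+-mono-≤ (rankTerm≤g D₁ S₁ B₁∈) (rankTerm≤g D₂ S₂ B₂∈))
    g-×D≥ : g D₁ S₁ ℤ.+ g D₂ S₂ ℤ.≤ g (D₁ ×D D₂) (S₁ ++ S₂)
    g-×D≥ with g-attained D₁ S₁ | g-attained D₂ S₂
    ... | B₁ , B₁∈ , gB₁ | B₂ , B₂∈ , gB₂ =
      subst (ℤ._≤ g (D₁ ×D D₂) (S₁ ++ S₂)) (trans (rankTerm-++ S₁ S₂ B₁ B₂) (sym (cong₂ ℤ._+_ gB₁ gB₂)))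
        (rankTerm≤g (D₁ ×D D₂) (S₁ ++ S₂) (∈F-×D⁺ B₁∈ B₂∈))

size-g-even : ∀ {n} (D : SetSystem n) (S : Adm n) → ∃[ k ] + size S ℤ.- g D S ≡ + (k * 2)
size-g-even D S with g-attained D S
... | B , _ , gB = c , (begin
  + size S ℤ.- g D S
    ≡⟨ cong₂ (λ x y → + x ℤ.- y) (sym (capSize+capSize-bar≡size S B)) gB ⟩
  + (a + c) ℤ.- (+ a ℤ.- + c)
    ≡⟨ cong (ℤ._- (+ a ℤ.- + c)) (ℤ.pos-+ a c) ⟩
  (+ a ℤ.+ + c) ℤ.- (+ a ℤ.- + c)
    ≡⟨ [a+c]-[a-c]≡c*2 (+ a) (+ c) ⟩
  + c ℤ.* + 2
    ≡⟨ ℤ.pos-* c 2 ⟨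
  + (c * 2) ∎)
  where
  a = capSize S B
  c = capSize (bar S) B
  [a+c]-[a-c]≡c*2 : ∀ (a c : ℤ) → (a ℤ.+ c) ℤ.- (a ℤ.- c) ≡ c ℤ.* + 2
  [a+c]-[a-c]≡c*2 = ℤ-Solver.solve-∀

vExp-even : ∀ {n} (D : SetSystem n) (S : Adm n) {k} → + size S ℤ.- g D S ≡ + (k * 2) → vExp D S ≡ k
vExp-even D S {k} e = trans (cong (λ z → ℤ.∣ z ∣ ℕ./ 2) e) (m*n/n≡m k 2)

size-g-×D : ∀ {n₁ n₂} (D₁ : SetSystem n₁) (D₂ : SetSystem n₂) (S₁ : Adm n₁) (S₂ : Adm n₂) →
  + size (S₁ ++ S₂) ℤ.- g (D₁ ×D D₂) (S₁ ++ S₂) ≡ (+ size S₁ ℤ.- g D₁ S₁) ℤ.+ (+ size S₂ ℤ.- g D₂ S₂)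
size-g-×D D₁ D₂ S₁ S₂ = begin
  + size (S₁ ++ S₂) ℤ.- g (D₁ ×D D₂) (S₁ ++ S₂)
    ≡⟨ cong₂ (λ x y → + x ℤ.- y) (size-++ S₁ S₂) (g-×D D₁ D₂ S₁ S₂) ⟩
  + (size S₁ + size S₂) ℤ.- (g D₁ S₁ ℤ.+ g D₂ S₂)
    ≡⟨ cong (ℤ._- (g D₁ S₁ ℤ.+ g D₂ S₂)) (ℤ.pos-+ (size S₁) (size S₂)) ⟩
  (+ size S₁ ℤ.+ + size S₂) ℤ.- (g D₁ S₁ ℤ.+ g D₂ S₂)
    ≡⟨ [a+b]-[c+d]≡[a-c]+[b-d] (+ size S₁) (+ size S₂) (g D₁ S₁) (g D₂ S₂) ⟩
  (+ size S₁ ℤ.- g D₁ S₁) ℤ.+ (+ size S₂ ℤ.- g D₂ S₂) ∎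

vExp-×D : ∀ {n₁ n₂} (D₁ : SetSystem n₁) (D₂ : SetSystem n₂) (S₁ : Adm n₁) (S₂ : Adm n₂) →
  vExp (D₁ ×D D₂) (S₁ ++ S₂) ≡ vExp D₁ S₁ + vExp D₂ S₂
vExp-×D D₁ D₂ S₁ S₂ =
  let k₁ , e₁ = size-g-even D₁ S₁
      k₂ , e₂ = size-g-even D₂ S₂
      even : + size (S₁ ++ S₂) ℤ.- g (D₁ ×D D₂) (S₁ ++ S₂) ≡ + ((k₁ + k₂) * 2)
      even = begin
        + size (S₁ ++ S₂) ℤ.- g (D₁ ×D D₂) (S₁ ++ S₂) ≡⟨ size-g-×D D₁ D₂ S₁ S₂ ⟩
        (+ size S₁ ℤ.- g D₁ S₁) ℤ.+ (+ size S₂ ℤ.- g D₂ S₂) ≡⟨ cong₂ ℤ._+_ e₁ e₂ ⟩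
        + (k₁ * 2) ℤ.+ + (k₂ * 2)                           ≡⟨ ℤ.pos-+ (k₁ * 2) (k₂ * 2) ⟨
        + (k₁ * 2 + k₂ * 2)                                 ≡⟨ cong +_ (*-distribʳ-+ 2 k₁ k₂) ⟨
        + ((k₁ + k₂) * 2)                                   ∎
  in trans (vExp-even (D₁ ×D D₂) (S₁ ++ S₂) {k₁ + k₂} even)
        (sym (cong₂ _+_ (vExp-even D₁ S₁ {k₁} e₁) (vExp-even D₂ S₂ {k₂} e₂)))

𝟙 : Bool → ℕ
𝟙 true  = 1
𝟙 false = 0

𝟙-∧ : ∀ p q → 𝟙 (p ∧ q) ≡ 𝟙 p * 𝟙 q
𝟙-∧ true  q = sym (*-identityˡ (𝟙 q))
𝟙-∧ false q = refl

δ : ℕ → ℕ → ℕ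
δ m n = 𝟙 (does (m ℕ.≟ n))

δ-≡ : ∀ {m n} → m ≡ n → δ m n ≡ 1
δ-≡ {m} {n} m≡n = cong 𝟙 (dec-true (m ℕ.≟ n) m≡n)

δ-≢ : ∀ {m n} → ¬ m ≡ n → δ m n ≡ 0
δ-≢ {m} {n} m≢n = cong 𝟙 (dec-false (m ℕ.≟ n) m≢n)

δ-cong : ∀ {m n p q} → (m ≡ n → p ≡ q) → (p ≡ q → m ≡ n) → δ m n ≡ δ p q
δ-cong {m} {n} to from with m ℕ.≟ n
... | yes m≡n = trans (δ-≡ m≡n) (sym (δ-≡ (to m≡n)))
... | no  m≢n = trans (δ-≢ m≢n) (sym (δ-≢ (λ p≡q → m≢n (from p≡q))))

monomial : ℕ → ℕ → Poly
monomial i j a b = δ i a * δ j b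

sumUpTo-cong : ∀ a {F G : ℕ → ℕ} → (∀ k → F k ≡ G k) → sumUpTo a F ≡ sumUpTo a G
sumUpTo-cong zero    F≗G = F≗G 0
sumUpTo-cong (suc a) F≗G = cong₂ _+_ (sumUpTo-cong a F≗G) (F≗G (suc a))

sumUpTo-*ˡ : ∀ a c (F : ℕ → ℕ) → c * sumUpTo a F ≡ sumUpTo a (λ k → c * F k)
sumUpTo-*ˡ zero    c F = refl
sumUpTo-*ˡ (suc a) c F =
  trans (*-distribˡ-+ c (sumUpTo a F) _) (cong (_+ c * F (suc a)) (sumUpTo-*ˡ a c F))

sumUpTo-*ʳ : ∀ a c (F : ℕ → ℕ) → sumUpTo a F * c ≡ sumUpTo a (λ k → F k * c)
sumUpTo-*ʳ zero    c F = refl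
sumUpTo-*ʳ (suc a) c F =
  trans (*-distribʳ-+ c (sumUpTo a F) _) (cong (_+ F (suc a) * c) (sumUpTo-*ʳ a c F))

sumUpTo-*-sumUpTo : ∀ a b (F G : ℕ → ℕ) →
  sumUpTo a F * sumUpTo b G ≡ sumUpTo a (λ i → sumUpTo b (λ j → F i * G j))
sumUpTo-*-sumUpTo a b F G =
  trans (sumUpTo-*ʳ a (sumUpTo b G) F) (sumUpTo-cong a (λ i → sumUpTo-*ˡ b (F i) G))

sumUpTo-δ-> : ∀ a {i} (F : ℕ → ℕ) → a < i → sumUpTo a (λ k → δ i k * F k) ≡ 0
sumUpTo-δ-> zero    F a<i = cong (_* F 0) (δ-≢ (λ i≡0 → <-irrefl (sym i≡0) a<i))
sumUpTo-δ-> (suc a) F a<i =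
  cong₂ _+_ (sumUpTo-δ-> a F (<-trans (n<1+n a) a<i))
            (cong (_* F (suc a)) (δ-≢ (λ i≡a → <-irrefl (sym i≡a) a<i)))

sumUpTo-δ-≤ : ∀ a {i} (F : ℕ → ℕ) → i ≤ a → sumUpTo a (λ k → δ i k * F k) ≡ F i
sumUpTo-δ-≤ zero    F z≤n = +-identityʳ (F 0)
sumUpTo-δ-≤ (suc a) {i} F i≤1+a with m≤n⇒m<n∨m≡n i≤1+a
... | inj₁ i<1+a = begin
  sumUpTo a (λ k → δ i k * F k) + δ i (suc a) * F (suc a)
    ≡⟨ cong₂ _+_ (sumUpTo-δ-≤ a F (≤-pred i<1+a)) (cong (_* F (suc a)) (δ-≢ (λ i≡1+a → <-irrefl i≡1+a i<1+a))) ⟩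
  F i + 0
    ≡⟨ +-identityʳ (F i) ⟩
  F i ∎
... | inj₂ refl = begin
  sumUpTo a (λ k → δ i k * F k) + δ i i * F i
    ≡⟨ cong₂ _+_ (sumUpTo-δ-> a F (n<1+n a)) (cong (_* F i) (δ-≡ {i} refl)) ⟩
  F i + 0
    ≡⟨ +-identityʳ (F i) ⟩
  F i ∎

δ-convolution : ∀ a i j → sumUpTo a (λ k → δ i k * δ j (a ∸ k)) ≡ δ (i + j) a
δ-convolution a i j with i ℕ.≤? a
... | yes i≤a = trans (sumUpTo-δ-≤ a (λ k → δ j (a ∸ k)) i≤a)
  (δ-cong (λ j≡a∸i → trans (cong (λ k → i + k) j≡a∸i) (m+[n∸m]≡n i≤a))
          (λ i+j≡a → trans (sym (m+n∸m≡n i j)) (cong (_∸ i) i+j≡a)))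
... | no  i≰a = trans (sumUpTo-δ-> a (λ k → δ j (a ∸ k)) (≰⇒> i≰a))
  (sym (δ-≢ (λ i+j≡a → i≰a (subst (i ≤_) i+j≡a (m≤m+n i j)))))

monomial-*ᴾ : ∀ i₁ j₁ i₂ j₂ a b →
  (monomial i₁ j₁ *ᴾ monomial i₂ j₂) a b ≡ monomial (i₁ + i₂) (j₁ + j₂) a b
monomial-*ᴾ i₁ j₁ i₂ j₂ a b = begin
  sumUpTo a (λ a₁ → sumUpTo b (λ b₁ → (δ i₁ a₁ * δ j₁ b₁) * (δ i₂ (a ∸ a₁) * δ j₂ (b ∸ b₁))))
    ≡⟨ sumUpTo-cong a (λ a₁ → sumUpTo-cong b (λ b₁ → interchange (δ i₁ a₁) _ _ _)) ⟩
  sumUpTo a (λ a₁ → sumUpTo b (λ b₁ → (δ i₁ a₁ * δ i₂ (a ∸ a₁)) * (δ j₁ b₁ * δ j₂ (b ∸ b₁))))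
    ≡⟨ sumUpTo-*-sumUpTo a b _ _ ⟨
  sumUpTo a (λ a₁ → δ i₁ a₁ * δ i₂ (a ∸ a₁)) * sumUpTo b (λ b₁ → δ j₁ b₁ * δ j₂ (b ∸ b₁))
    ≡⟨ cong₂ _*_ (δ-convolution a i₁ i₂) (δ-convolution b j₁ j₂) ⟩
  δ (i₁ + i₂) a * δ (j₁ + j₂) b ∎
  where
  interchange : ∀ w x y z → (w * x) * (y * z) ≡ (w * y) * (x * z)
  interchange = ℕ-Solver.solve-∀

*ᴾ-cong : ∀ {P P′ Q Q′ : Poly} → (∀ i j → P i j ≡ P′ i j) → (∀ i j → Q i j ≡ Q′ i j) →
  ∀ a b → (P *ᴾ Q) a b ≡ (P′ *ᴾ Q′) a b
*ᴾ-cong P≗P′ Q≗Q′ a b =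
  sumUpTo-cong a (λ i → sumUpTo-cong b (λ j → cong₂ _*_ (P≗P′ i j) (Q≗Q′ (a ∸ i) (b ∸ j))))

ΣAdm : (n : ℕ) → (Adm n → ℕ) → ℕ
ΣAdm zero    h = h []
ΣAdm (suc n) h = ΣAdm n (λ S → h (nothing ∷ S) + h (just true ∷ S) + h (just false ∷ S))

ΣAdmᴾ : (n : ℕ) → (Adm n → Poly) → Poly
ΣAdmᴾ n P a b = ΣAdm n (λ S → P S a b)

ΣAdm-cong : ∀ n {h h′ : Adm n → ℕ} → (∀ S → h S ≡ h′ S) → ΣAdm n h ≡ ΣAdm n h′
ΣAdm-cong zero    h≗h′ = h≗h′ []
ΣAdm-cong (suc n) h≗h′ = ΣAdm-cong n (λ S → cong₂ _+_ (cong₂ _+_ (h≗h′ _) (h≗h′ _)) (h≗h′ _))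

ΣAdm-+ : ∀ n (h h′ : Adm n → ℕ) → ΣAdm n (λ S → h S + h′ S) ≡ ΣAdm n h + ΣAdm n h′
ΣAdm-+ zero    h h′ = refl
ΣAdm-+ (suc n) h h′ =
  trans (ΣAdm-cong n (λ S → regroup (h _) (h _) (h _) (h′ _) (h′ _) (h′ _))) (ΣAdm-+ n _ _)
  where
  regroup : ∀ a b c d e f → (a + d) + (b + e) + (c + f) ≡ (a + b + c) + (d + e + f)
  regroup = ℕ-Solver.solve-∀

ΣAdm-*ˡ : ∀ n c (h : Adm n → ℕ) → c * ΣAdm n h ≡ ΣAdm n (λ S → c * h S)
ΣAdm-*ˡ zero    c h = refl
ΣAdm-*ˡ (suc n) c h = trans (ΣAdm-*ˡ n c _) (ΣAdm-cong n (λ S → distrib c (h _) (h _) (h _)))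
  where
  distrib : ∀ c a b d → c * (a + b + d) ≡ c * a + c * b + c * d
  distrib = ℕ-Solver.solve-∀

ΣAdm-*-ΣAdm : ∀ n₁ n₂ (h₁ : Adm n₁ → ℕ) (h₂ : Adm n₂ → ℕ) →
  ΣAdm n₁ h₁ * ΣAdm n₂ h₂ ≡ ΣAdm n₁ (λ S₁ → ΣAdm n₂ (λ S₂ → h₁ S₁ * h₂ S₂))
ΣAdm-*-ΣAdm n₁ n₂ h₁ h₂ = begin
  ΣAdm n₁ h₁ * ΣAdm n₂ h₂                           ≡⟨ *-comm (ΣAdm n₁ h₁) _ ⟩
  ΣAdm n₂ h₂ * ΣAdm n₁ h₁                           ≡⟨ ΣAdm-*ˡ n₁ (ΣAdm n₂ h₂) h₁ ⟩
  ΣAdm n₁ (λ S₁ → ΣAdm n₂ h₂ * h₁ S₁)               ≡⟨ ΣAdm-cong n₁ (λ S₁ → *-comm _ (h₁ S₁)) ⟩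
  ΣAdm n₁ (λ S₁ → h₁ S₁ * ΣAdm n₂ h₂)               ≡⟨ ΣAdm-cong n₁ (λ S₁ → ΣAdm-*ˡ n₂ (h₁ S₁) h₂) ⟩
  ΣAdm n₁ (λ S₁ → ΣAdm n₂ (λ S₂ → h₁ S₁ * h₂ S₂))   ∎

ΣAdm-++ : ∀ n₁ n₂ (h : Adm (n₁ + n₂) → ℕ) →
  ΣAdm (n₁ + n₂) h ≡ ΣAdm n₁ (λ S₁ → ΣAdm n₂ (λ S₂ → h (S₁ ++ S₂)))
ΣAdm-++ zero     n₂ h = refl
ΣAdm-++ (suc n₁) n₂ h = trans (ΣAdm-++ n₁ n₂ _) (ΣAdm-cong n₁ (λ S₁ →
  trans (ΣAdm-+ n₂ _ _) (cong (_+ ΣAdm n₂ (λ S₂ → h (just false ∷ S₁ ++ S₂))) (ΣAdm-+ n₂ _ _))))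

sumUpTo-ΣAdm : ∀ a n (h : ℕ → Adm n → ℕ) →
  sumUpTo a (λ k → ΣAdm n (h k)) ≡ ΣAdm n (λ S → sumUpTo a (λ k → h k S))
sumUpTo-ΣAdm zero    n h = refl
sumUpTo-ΣAdm (suc a) n h = trans (cong (_+ ΣAdm n (h (suc a))) (sumUpTo-ΣAdm a n h)) (sym (ΣAdm-+ n _ _))

sumUpTo²-ΣAdm : ∀ a b n (h : ℕ → ℕ → Adm n → ℕ) →
  sumUpTo a (λ i → sumUpTo b (λ j → ΣAdm n (h i j))) ≡
  ΣAdm n (λ S → sumUpTo a (λ i → sumUpTo b (λ j → h i j S)))
sumUpTo²-ΣAdm a b n h =
  trans (sumUpTo-cong a (λ i → sumUpTo-ΣAdm b n (h i))) (sumUpTo-ΣAdm a n _)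

ΣAdmᴾ-*ᴾ : ∀ n₁ n₂ (P : Adm n₁ → Poly) (Q : Adm n₂ → Poly) a b →
  (ΣAdmᴾ n₁ P *ᴾ ΣAdmᴾ n₂ Q) a b ≡ ΣAdm n₁ (λ S₁ → ΣAdm n₂ (λ S₂ → (P S₁ *ᴾ Q S₂) a b))
ΣAdmᴾ-*ᴾ n₁ n₂ P Q a b =
  trans (sumUpTo-cong a (λ i → sumUpTo-cong b (λ j → ΣAdm-*-ΣAdm n₁ n₂ _ _)))
  (trans (sumUpTo²-ΣAdm a b n₁ _)
         (ΣAdm-cong n₁ (λ S₁ → sumUpTo²-ΣAdm a b n₂ _)))

count≡sum-map-𝟙 : ∀ {A : Set} (p : A → Bool) (xs : List A) →
  count p xs ≡ sum (List.map (λ x → 𝟙 (p x)) xs)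
count≡sum-map-𝟙 p List.[]       = refl
count≡sum-map-𝟙 p (x List.∷ xs) with p x
... | true  = cong suc (count≡sum-map-𝟙 p xs)
... | false = count≡sum-map-𝟙 p xs

sum-map-concatMap : ∀ {A B : Set} (f : A → List B) (h : B → ℕ) (xs : List A) →
  sum (List.map h (List.concatMap f xs)) ≡ sum (List.map (λ x → sum (List.map h (f x))) xs)
sum-map-concatMap f h List.[]       = refl
sum-map-concatMap f h (x List.∷ xs) =
  trans (cong sum (map-++ h (f x) (List.concatMap f xs)))
  (trans (sum-++ (List.map h (f x)) _)
         (cong (λ s → sum (List.map h (f x)) + s) (sum-map-concatMap f h xs)))

sum-map-AdS : ∀ n (h : Adm n → ℕ) → sum (List.map h (AdS n)) ≡ ΣAdm n h
sum-map-AdS zero    h = +-identityʳ (h [])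
sum-map-AdS (suc n) h = trans (sum-map-concatMap _ h (AdS n))
  (trans (sum-map-AdS n _) (ΣAdm-cong n (λ S → reassoc (h _) (h _) (h _))))
  where
  reassoc : ∀ a b c → a + (b + (c + 0)) ≡ a + b + c
  reassoc = ℕ-Solver.solve-∀

[m+n]∸[o+p]≡[m∸o]+[n∸p] : ∀ {m n o p} → o ≤ m → p ≤ n → (m + n) ∸ (o + p) ≡ (m ∸ o) + (n ∸ p)
[m+n]∸[o+p]≡[m∸o]+[n∸p] {m} {n} {o} {p} o≤m p≤n = begin
  (m + n) ∸ (o + p) ≡⟨ ∸-+-assoc (m + n) o p ⟨
  (m + n) ∸ o ∸ p   ≡⟨ cong (_∸ p) (+-∸-comm n o≤m) ⟩
  (m ∸ o + n) ∸ p   ≡⟨ +-∸-assoc (m ∸ o) p≤n ⟩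
  (m ∸ o) + (n ∸ p) ∎

Uterm : ∀ {n} → SetSystem n → Adm n → Poly
Uterm {n} D S = monomial (n ∸ size S) (vExp D S)

U≡ΣAdmᴾ-Uterm : ∀ {n} (D : SetSystem n) a b → U D a b ≡ ΣAdmᴾ n (Uterm D) a b
U≡ΣAdmᴾ-Uterm {n} D a b =
  trans (count≡sum-map-𝟙 _ (AdS n))
  (trans (sum-map-AdS n _) (ΣAdm-cong n (λ S → 𝟙-∧ (does (n ∸ size S ℕ.≟ a)) _)))

Uterm-×D : ∀ {n₁ n₂} (D₁ : SetSystem n₁) (D₂ : SetSystem n₂) (S₁ : Adm n₁) (S₂ : Adm n₂) a b →
  Uterm (D₁ ×D D₂) (S₁ ++ S₂) a b ≡ (Uterm D₁ S₁ *ᴾ Uterm D₂ S₂) a b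
Uterm-×D {n₁} {n₂} D₁ D₂ S₁ S₂ a b =
  trans (cong₂ (λ i j → monomial i j a b)
          (trans (cong (n₁ + n₂ ∸_) (size-++ S₁ S₂)) ([m+n]∸[o+p]≡[m∸o]+[n∸p] (size≤n S₁) (size≤n S₂)))
          (vExp-×D D₁ D₂ S₁ S₂))
        (sym (monomial-*ᴾ (n₁ ∸ size S₁) (vExp D₁ S₁) (n₂ ∸ size S₂) (vExp D₂ S₂) a b))

lemma3p2 : {n₁ n₂ : ℕ} (D₁ : SetSystem n₁) (D₂ : SetSystem n₂) →
    IsDeltaMatroid D₁ → IsDeltaMatroid D₂ →
    (a b : ℕ) → U (D₁ ×D D₂) a b ≡ (U D₁ *ᴾ U D₂) a b
lemma3p2 {n₁} {n₂} D₁ D₂ _ _ a b = begin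
  U (D₁ ×D D₂) a b
    ≡⟨ U≡ΣAdmᴾ-Uterm (D₁ ×D D₂) a b ⟩
  ΣAdm (n₁ + n₂) (λ S → Uterm (D₁ ×D D₂) S a b)
    ≡⟨ ΣAdm-++ n₁ n₂ _ ⟩
  ΣAdm n₁ (λ S₁ → ΣAdm n₂ (λ S₂ → Uterm (D₁ ×D D₂) (S₁ ++ S₂) a b))
    ≡⟨ ΣAdm-cong n₁ (λ S₁ → ΣAdm-cong n₂ (λ S₂ → Uterm-×D D₁ D₂ S₁ S₂ a b)) ⟩
  ΣAdm n₁ (λ S₁ → ΣAdm n₂ (λ S₂ → (Uterm D₁ S₁ *ᴾ Uterm D₂ S₂) a b))
    ≡⟨ ΣAdmᴾ-*ᴾ n₁ n₂ (Uterm D₁) (Uterm D₂) a b ⟨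
  (ΣAdmᴾ n₁ (Uterm D₁) *ᴾ ΣAdmᴾ n₂ (Uterm D₂)) a b
    ≡⟨ *ᴾ-cong (U≡ΣAdmᴾ-Uterm D₁) (U≡ΣAdmᴾ-Uterm D₂) a b ⟨
  (U D₁ *ᴾ U D₂) a b ∎
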